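{- Let $n\ge3$, $k\in\{2,\ldots,n-1\}$, and let $N$ be an optimal solution for the problem instance $T^{k,n}$ defined in the context. Then $f_{T^{k,n}}(N)=2^{n-1}\binom{n-1}{k}$.
   Context: Binary attributes $V_1,\ldots,V_n$, each with domain $\{0,1\}$. For $Q\subseteq\{V_1,\ldots,V_{n-1}\}$, $\mathrm{Inst}(Q)$ is the set of assignments of values in $\{0,1\}$ to the attributes of $Q$ (contexts). A (complete) CPT $N$ for $V_n$ consists of a parent set $Pa(N,V_n)\subseteq\{V_1,\ldots,V_{n-1}\}$ and, for each $\gamma\in\mathrm{Inst}(Pa(N,V_n))$, exactly one rule, either $\gamma:0\succ 1$ or $\gamma:1\succ 0$. A swap over $V_n$ is identified with an element $x\in\{0,1\}^{n-1}$; the vote of $N$ on $x$ is $0$ if the rule of $N$ whose context agrees with $x$ on $Pa(N,V_n)$ is of the form $\gamma:0\succ1$, and $1$ otherwise. $\Delta(N,N')$ is the number of swaps on which $N,N'$ vote differently. For a problem instance $T=(N_1,\ldots,N_t)$, $f_T(N)=\sum_{s=1}^t\Delta(N,N_s)$; an optimal solution is a CPT for $V_n$ (any parent set $\subseteq\{V_1,\ldots,V_{n-1}\}$) minimizing $f_T$. The instance $T^{k,n}=(N_1,\ldots,N_t)$ has $t=\binom{n-1}{k}2^k$, with indices $s$ in bijection with pairs $(P,\gamma)$, $P$ a $k$-element subset of $\{V_1,\ldots,V_{n-1}\}$ and $\gamma\in\mathrm{Inst}(P)$; the CPT $N_s$ for $(P,\gamma)$ has parent set $P$, the rule $\gamma:1\succ0$,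 and $\gamma':0\succ1$ for all $\gamma'\in\mathrm{Inst}(P)\setminus\{\gamma\}$. -}

module Defs where

open import Data.Bool using (Bool; true; false; if_then_else_)
open import Data.Nat using (ℕ; zero; suc; _+_; _≟_; _≤_)
open import Data.Vec using (Vec; []; _∷_)
open import Data.Vec.Properties using (≡-dec)
import Data.Bool.Properties as BoolP
open import Data.List using (List; []; _∷_; map; concatMap; filter; length; _++_)
open import Data.Nat.ListAction using (sum)
open import Data.Product using (Σ; _,_; proj₁; proj₂)
open import Relation.Nullary.Decidable using (⌊_⌋; ¬?)
open import Relation.Binary.PropositionalEquality using (_≡_)

-- Attributes V_1..V_m (m = n-1) are indexed by positions 0..m-1 of a vector.
-- Values: false = 0, true = 1.

-- A swap over V_n: an element of {0,1}^m.
Swap : ℕ → Set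
Swap m = Vec Bool m

ParentSet : ℕ → Set
ParentSet m = Vec Bool m

size : ∀ {m} → ParentSet m → ℕ
size [] = 0
size (true ∷ P) = suc (size P)
size (false ∷ P) = size P

-- Inst(P): assignments to the attributes of P, listed in increasing index order.
Inst : ∀ {m} → ParentSet m → Set
Inst P = Vec Bool (size P)

restrict : ∀ {m} (P : ParentSet m) → Swap m → Inst P
restrict [] [] = []
restrict (true ∷ P) (b ∷ x) = b ∷ restrict P x
restrict (false ∷ P) (b ∷ x) = restrict P x

-- A complete CPT for V_n: a parent set and, for each context γ, exactly one rule,
-- encoded as a Bool: false means γ:0≻1, true means γ:1≻0.
record CPT (m : ℕ) : Set where
  constructor cpt
  field
    parents : ParentSet m
    rule    : Inst parents → Bool
open CPT public

vote : ∀ {m} → CPT m → Swap m → Bool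
vote N x = rule N (restrict (parents N) x)

allVecs : (m : ℕ) → List (Vec Bool m)
allVecs zero = [] ∷ []
allVecs (suc m) = map (false ∷_) (allVecs m) ++ map (true ∷_) (allVecs m)

Δ : ∀ {m} → CPT m → CPT m → ℕ
Δ {m} N N' = length (filter (λ x → ¬? (vote N x BoolP.≟ vote N' x)) (allVecs m))

Instance : ℕ → Set
Instance m = List (CPT m)

f : ∀ {m} → Instance m → CPT m → ℕ
f T N = sum (map (Δ N) T)

Optimal : ∀ {m} → Instance m → CPT m → Set
Optimal {m} T N = ∀ (N' : CPT m) → f T N ≤ f T N'

indicatorCPT : ∀ {m} (P : ParentSet m) → Inst P → CPT m
indicatorCPT P γ = cpt P (λ γ' → ⌊ ≡-dec BoolP._≟_ γ' γ ⌋)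

kSubsets : (m k : ℕ) → List (ParentSet m)
kSubsets m k = filter (λ P → size P ≟ k) (allVecs m)

Tkn : (m k : ℕ) → Instance m
Tkn m k = concatMap (λ P → map (indicatorCPT P) (allVecs (size P))) (kSubsets m k)

-- Every CPT N_s of T^{k,n} votes 1 on a swap x exactly when its context γ is the restriction
-- of x to its parent set P.  Hence, for each x and each k-set P, exactly one of the 2^k CPTs
-- (P, γ) votes 1 while at least one votes 0 (k ≥ 1).  Voting 0 on x therefore costs exactly
-- C(n-1,k) disagreements and voting 1 costs at least as much, so the constant-0 CPT attains
-- the pointwise minimum on all 2^(n-1) swaps and every optimal CPT has its value.
module Submission where

open import Defs
open import Data.Bool using (Bool; true; false; not; _xor_; if_then_else_)
import Data.Bool.Properties as Bool
open import Data.List using (List; []; _∷_; _++_; map; concatMap; filter; length)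
open import Data.List.Properties using (map-cong; map-∘; map-++; length-++; length-map)
open import Data.List.Membership.Propositional using (_∈_)
open import Data.List.Membership.Propositional.Properties using (∈-map⁺; ∈-++⁺ˡ; ∈-++⁺ʳ)
open import Data.List.Relation.Unary.All as All using (All; []; _∷_)
open import Data.List.Relation.Unary.All.Properties using (all-filter)
open import Data.List.Relation.Unary.Any using (here; there)
open import Data.Nat using (ℕ; zero; suc; _+_; _*_; _^_; _∸_; _≤_; _≟_; z≤n; s≤s)
open import Data.Nat.Combinatorics using (_C_; nCk+nC[k+1]≡[n+1]C[k+1])
open import Data.Nat.ListAction using (sum)
open import Data.Nat.ListAction.Properties using (sum-++)
open import Data.Nat.Properties
  using (+-comm; +-identityʳ; *-identityʳ; *-zeroʳ; +-mono-≤; ≤-refl; ≤-reflexive;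
         ≤-trans; ≤-antisym; m≤m+n; m≤n+m; <⇒≤; module ≤-Reasoning)
open import Data.Nat.Solver using (module +-*-Solver)
open import Data.Vec using (Vec; []; _∷_; replicate)
open import Data.Vec.Properties using (≡-dec)
open import Function using (_∘_; const)
open import Relation.Nullary using (does; ¬?)
open import Relation.Nullary.Decidable using (isYes≗does)
open import Relation.Unary using (Pred; Decidable)
open import Relation.Binary.Definitions using (DecidableEquality)
open import Relation.Binary.PropositionalEquality using (_≡_; refl; sym; trans; cong; cong₂; module ≡-Reasoning)

𝟙 : Bool → ℕ
𝟙 b = if b then 1 else 0

module _ {a} {A : Set a} where

  length-filter≡sum-𝟙 : ∀ {p} {P : Pred A p} (P? : Decidable P) (xs : List A) →
                        length (filter P? xs) ≡ sum (map (𝟙 ∘ does ∘ P?) xs)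
  length-filter≡sum-𝟙 P? [] = refl
  length-filter≡sum-𝟙 P? (x ∷ xs) with does (P? x)
  ... | true  = cong suc (length-filter≡sum-𝟙 P? xs)
  ... | false = length-filter≡sum-𝟙 P? xs

  sum-map-cong : {g h : A → ℕ} → (∀ x → g x ≡ h x) → (xs : List A) → sum (map g xs) ≡ sum (map h xs)
  sum-map-cong g≗h xs = cong sum (map-cong g≗h xs)

  sum-map-const : (c : ℕ) (xs : List A) → sum (map (const c) xs) ≡ length xs * c
  sum-map-const c [] = refl
  sum-map-const c (x ∷ xs) = cong (c +_) (sum-map-const c xs)

  sum-map-zero : (xs : List A) → sum (map (const 0) xs) ≡ 0
  sum-map-zero xs = trans (sum-map-const 0 xs) (*-zeroʳ (length xs))

  sum-map-+ : (g h : A → ℕ) (xs : List A) →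
              sum (map (λ x → g x + h x) xs) ≡ sum (map g xs) + sum (map h xs)
  sum-map-+ g h [] = refl
  sum-map-+ g h (x ∷ xs) = begin
    g x + h x + sum (map (λ x → g x + h x) xs)     ≡⟨ cong (g x + h x +_) (sum-map-+ g h xs) ⟩
    g x + h x + (sum (map g xs) + sum (map h xs))  ≡⟨ solve 4 (λ a b c d → a :+ b :+ (c :+ d) := a :+ c :+ (b :+ d))
                                                          refl (g x) (h x) (sum (map g xs)) (sum (map h xs)) ⟩
    g x + sum (map g xs) + (h x + sum (map h xs))  ∎
    where open ≡-Reasoning
          open +-*-Solver

  sum-map-mono-≤ : {g h : A → ℕ} {xs : List A} → All (λ x → g x ≤ h x) xs →
                   sum (map g xs) ≤ sum (map h xs)
  sum-map-mono-≤ [] = z≤n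
  sum-map-mono-≤ (gx≤hx ∷ g≤h) = +-mono-≤ gx≤hx (sum-map-mono-≤ g≤h)

  ∈⇒≤-sum-map : (g : A → ℕ) {x : A} {xs : List A} → x ∈ xs → g x ≤ sum (map g xs)
  ∈⇒≤-sum-map g {xs = y ∷ ys} (here refl) = m≤m+n (g y) (sum (map g ys))
  ∈⇒≤-sum-map g {xs = y ∷ ys} (there x∈ys) = ≤-trans (∈⇒≤-sum-map g x∈ys) (m≤n+m _ (g y))

module _ {a b} {A : Set a} {B : Set b} where

  sum-map-concatMap : (g : B → ℕ) (h : A → List B) (xs : List A) →
                      sum (map g (concatMap h xs)) ≡ sum (map (λ x → sum (map g (h x))) xs)
  sum-map-concatMap g h [] = refl
  sum-map-concatMap g h (x ∷ xs) = begin
    sum (map g (h x ++ concatMap h xs))               ≡⟨ cong sum (map-++ g (h x) _) ⟩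
    sum (map g (h x) ++ map g (concatMap h xs))       ≡⟨ sum-++ (map g (h x)) _ ⟩
    sum (map g (h x)) + sum (map g (concatMap h xs))  ≡⟨ cong (sum (map g (h x)) +_) (sum-map-concatMap g h xs) ⟩
    sum (map g (h x)) + sum (map (λ x → sum (map g (h x))) xs) ∎
    where open ≡-Reasoning

  sum-map-comm : (F : A → B → ℕ) (xs : List A) (ys : List B) →
                 sum (map (λ x → sum (map (F x) ys)) xs) ≡ sum (map (λ y → sum (map (λ x → F x y) xs)) ys)
  sum-map-comm F [] ys = sym (sum-map-zero ys)
  sum-map-comm F (x ∷ xs) ys =
    trans (cong (sum (map (F x) ys) +_) (sum-map-comm F xs ys)) (sym (sum-map-+ (F x) _ ys))

length-allVecs : ∀ m → length (allVecs m) ≡ 2 ^ m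
length-allVecs zero = refl
length-allVecs (suc m) = begin
  length (map (false ∷_) (allVecs m) ++ map (true ∷_) (allVecs m))  ≡⟨ length-++ (map (false ∷_) (allVecs m)) ⟩
  length (map (false ∷_) (allVecs m)) + length (map (true ∷_) (allVecs m))
    ≡⟨ cong₂ _+_ (length-map _ (allVecs m)) (length-map _ (allVecs m)) ⟩
  length (allVecs m) + length (allVecs m)                           ≡⟨ cong (λ l → l + l) (length-allVecs m) ⟩
  2 ^ m + 2 ^ m                                                     ≡⟨ cong (2 ^ m +_) (sym (+-identityʳ (2 ^ m))) ⟩
  2 ^ suc m                                                         ∎
  where open ≡-Reasoning

∈-allVecs : ∀ {m} (v : Vec Bool m) → v ∈ allVecs m
∈-allVecs [] = here refl
∈-allVecs (false ∷ v) = ∈-++⁺ˡ (∈-map⁺ (false ∷_) (∈-allVecs v))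
∈-allVecs (true ∷ v) = ∈-++⁺ʳ (map (false ∷_) (allVecs _)) (∈-map⁺ (true ∷_) (∈-allVecs v))

sum-map-allVecs-suc : ∀ m (g : Vec Bool (suc m) → ℕ) →
  sum (map g (allVecs (suc m))) ≡ sum (map (g ∘ (false ∷_)) (allVecs m)) + sum (map (g ∘ (true ∷_)) (allVecs m))
sum-map-allVecs-suc m g = begin
  sum (map g (map (false ∷_) (allVecs m) ++ map (true ∷_) (allVecs m)))
    ≡⟨ cong sum (map-++ g (map (false ∷_) (allVecs m)) _) ⟩
  sum (map g (map (false ∷_) (allVecs m)) ++ map g (map (true ∷_) (allVecs m)))
    ≡⟨ sum-++ (map g (map (false ∷_) (allVecs m))) _ ⟩
  sum (map g (map (false ∷_) (allVecs m))) + sum (map g (map (true ∷_) (allVecs m)))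
    ≡⟨ cong₂ _+_ (cong sum (sym (map-∘ (allVecs m)))) (cong sum (sym (map-∘ (allVecs m)))) ⟩
  sum (map (g ∘ (false ∷_)) (allVecs m)) + sum (map (g ∘ (true ∷_)) (allVecs m)) ∎
  where open ≡-Reasoning

_≟ᵥ_ : ∀ {m} → DecidableEquality (Vec Bool m)
_≟ᵥ_ = ≡-dec Bool._≟_

count-≡-allVecs : ∀ {m} (r : Vec Bool m) → sum (map (λ γ → 𝟙 (does (r ≟ᵥ γ))) (allVecs m)) ≡ 1
count-≡-allVecs [] = refl
count-≡-allVecs {suc m} (false ∷ r) = trans (sum-map-allVecs-suc m _)
  (cong₂ _+_ (count-≡-allVecs r) (sum-map-zero (allVecs m)))
count-≡-allVecs {suc m} (true ∷ r) = trans (sum-map-allVecs-suc m _)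
  (cong₂ _+_ (sum-map-zero (allVecs m)) (count-≡-allVecs r))

count-≢-allVecs-pos : ∀ {m} → 1 ≤ m → (r : Vec Bool m) → 1 ≤ sum (map (λ γ → 𝟙 (not (does (r ≟ᵥ γ)))) (allVecs m))
count-≢-allVecs-pos (s≤s z≤n) (b ∷ r) =
  ≤-trans (r≢flipped b) (∈⇒≤-sum-map (λ γ → 𝟙 (not (does ((b ∷ r) ≟ᵥ γ)))) (∈-allVecs (not b ∷ r)))
  where
  r≢flipped : ∀ b → 1 ≤ 𝟙 (not (does ((b ∷ r) ≟ᵥ (not b ∷ r))))
  r≢flipped false = ≤-refl
  r≢flipped true = ≤-refl

count-size≡-allVecs : ∀ m k → sum (map (λ P → 𝟙 (does (size P ≟ k))) (allVecs m)) ≡ m C k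
count-size≡-allVecs zero zero = refl
count-size≡-allVecs zero (suc k) = refl
count-size≡-allVecs (suc m) zero = trans (sum-map-allVecs-suc m _)
  (cong₂ _+_ (count-size≡-allVecs m zero) (sum-map-zero (allVecs m)))
count-size≡-allVecs (suc m) (suc k) = begin
  sum (map (λ P → 𝟙 (does (size P ≟ suc k))) (allVecs (suc m)))  ≡⟨ sum-map-allVecs-suc m _ ⟩
  sum (map (λ P → 𝟙 (does (size P ≟ suc k))) (allVecs m)) + sum (map (λ P → 𝟙 (does (size P ≟ k))) (allVecs m))
    ≡⟨ cong₂ _+_ (count-size≡-allVecs m (suc k)) (count-size≡-allVecs m k) ⟩
  m C suc k + m C k                                                ≡⟨ +-comm (m C suc k) (m C k) ⟩
  m C k + m C suc k                                                ≡⟨ nCk+nC[k+1]≡[n+1]C[k+1] m k ⟩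
  suc m C suc k                                                    ∎
  where open ≡-Reasoning

length-kSubsets : ∀ m k → length (kSubsets m k) ≡ m C k
length-kSubsets m k = trans (length-filter≡sum-𝟙 (λ P → size P ≟ k) (allVecs m)) (count-size≡-allVecs m k)

cost : ∀ {m} → Instance m → Swap m → Bool → ℕ
cost T x v = sum (map (λ N′ → 𝟙 (v xor vote N′ x)) T)

does-≢?≡xor : ∀ a b → does (¬? (a Bool.≟ b)) ≡ a xor b
does-≢?≡xor false false = refl
does-≢?≡xor false true = refl
does-≢?≡xor true false = refl
does-≢?≡xor true true = refl

Δ≡sum-xor : ∀ {m} (N N′ : CPT m) → Δ N N′ ≡ sum (map (λ x → 𝟙 (vote N x xor vote N′ x)) (allVecs m))
Δ≡sum-xor {m} N N′ = trans (length-filter≡sum-𝟙 (λ x → ¬? (vote N x Bool.≟ vote N′ x)) (allVecs m))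
  (sum-map-cong (λ x → cong 𝟙 (does-≢?≡xor (vote N x) (vote N′ x))) (allVecs m))

f≡sum-cost : ∀ {m} (T : Instance m) (N : CPT m) → f T N ≡ sum (map (λ x → cost T x (vote N x)) (allVecs m))
f≡sum-cost {m} T N = trans (sum-map-cong (Δ≡sum-xor N) T)
  (sum-map-comm (λ N′ x → 𝟙 (vote N x xor vote N′ x)) T (allVecs m))

constCPT : ∀ {m} → Bool → CPT m
constCPT b = cpt (replicate _ false) (const b)

optimal-value-of-pointwise-minimum : ∀ {m} (T : Instance m) (c : ℕ) →
  (∀ x → cost T x false ≡ c) → (∀ x v → c ≤ cost T x v) →
  (N : CPT m) → Optimal T N → f T N ≡ 2 ^ m * c
optimal-value-of-pointwise-minimum {m} T c cost-false≡c c≤cost N N-optimal =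
  ≤-antisym (≤-trans (N-optimal (constCPT false)) (≤-reflexive f-constCPT)) lower-bound
  where
  open ≤-Reasoning
  sum-c≡ : sum (map (const c) (allVecs m)) ≡ 2 ^ m * c
  sum-c≡ = trans (sum-map-const c (allVecs m)) (cong (_* c) (length-allVecs m))

  f-constCPT : f T (constCPT false) ≡ 2 ^ m * c
  f-constCPT = trans (f≡sum-cost T (constCPT false)) (trans (sum-map-cong cost-false≡c (allVecs m)) sum-c≡)

  lower-bound : 2 ^ m * c ≤ f T N
  lower-bound = begin
    2 ^ m * c                                            ≡⟨ sym sum-c≡ ⟩
    sum (map (const c) (allVecs m))                      ≤⟨ sum-map-mono-≤ {xs = allVecs m} (All.tabulate (λ {x} _ → c≤cost x (vote N x))) ⟩
    sum (map (λ x → cost T x (vote N x)) (allVecs m))    ≡⟨ sym (f≡sum-cost T N) ⟩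
    f T N                                                ∎

blockCost : ∀ {m} → ParentSet m → Swap m → Bool → ℕ
blockCost P x v = sum (map (λ γ → 𝟙 (v xor vote (indicatorCPT P γ) x)) (allVecs (size P)))

cost-Tkn : ∀ m k x v → cost (Tkn m k) x v ≡ sum (map (λ P → blockCost P x v) (kSubsets m k))
cost-Tkn m k x v = trans (sum-map-concatMap _ (λ P → map (indicatorCPT P) (allVecs (size P))) (kSubsets m k))
  (sum-map-cong (λ P → cong sum (sym (map-∘ (allVecs (size P))))) (kSubsets m k))

blockCost-false : ∀ {m} (P : ParentSet m) x → blockCost P x false ≡ 1
blockCost-false P x = trans (sum-map-cong (λ γ → cong 𝟙 (isYes≗does (restrict P x ≟ᵥ γ))) (allVecs (size P)))
  (count-≡-allVecs (restrict P x))

blockCost-true : ∀ {m} (P : ParentSet m) x → 1 ≤ size P → 1 ≤ blockCost P x true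
blockCost-true P x 1≤size = ≤-trans (count-≢-allVecs-pos 1≤size (restrict P x))
  (≤-reflexive (sum-map-cong (λ γ → cong (𝟙 ∘ not) (sym (isYes≗does (restrict P x ≟ᵥ γ)))) (allVecs (size P))))

cost-Tkn-false : ∀ m k x → cost (Tkn m k) x false ≡ m C k
cost-Tkn-false m k x = begin
  cost (Tkn m k) x false                               ≡⟨ cost-Tkn m k x false ⟩
  sum (map (λ P → blockCost P x false) (kSubsets m k))  ≡⟨ sum-map-cong (λ P → blockCost-false P x) (kSubsets m k) ⟩
  sum (map (const 1) (kSubsets m k))                   ≡⟨ sum-map-const 1 (kSubsets m k) ⟩
  length (kSubsets m k) * 1                            ≡⟨ *-identityʳ _ ⟩
  length (kSubsets m k)                                ≡⟨ length-kSubsets m k ⟩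
  m C k                                                ∎
  where open ≡-Reasoning

cost-Tkn-true : ∀ m k x → 1 ≤ k → m C k ≤ cost (Tkn m k) x true
cost-Tkn-true m k x 1≤k = begin
  m C k                                                ≡⟨ sym (length-kSubsets m k) ⟩
  length (kSubsets m k)                                ≡⟨ sym (*-identityʳ _) ⟩
  length (kSubsets m k) * 1                            ≡⟨ sym (sum-map-const 1 (kSubsets m k)) ⟩
  sum (map (const 1) (kSubsets m k))
    ≤⟨ sum-map-mono-≤ (All.map (λ {P} size≡k → blockCost-true P x (≤-trans 1≤k (≤-reflexive (sym size≡k))))
                               (all-filter (λ P → size P ≟ k) (allVecs m))) ⟩
  sum (map (λ P → blockCost P x true) (kSubsets m k))  ≡⟨ sym (cost-Tkn m k x true) ⟩
  cost (Tkn m k) x true                                ∎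
  where open ≤-Reasoning

C≤cost-Tkn : ∀ m k → 1 ≤ k → ∀ x v → m C k ≤ cost (Tkn m k) x v
C≤cost-Tkn m k 1≤k x false = ≤-reflexive (sym (cost-Tkn-false m k x))
C≤cost-Tkn m k 1≤k x true = cost-Tkn-true m k x 1≤k

lemma19 : ∀ (n k : ℕ) → 3 ≤ n → 2 ≤ k → k ≤ n ∸ 1 →
            (N : CPT (n ∸ 1)) → Optimal (Tkn (n ∸ 1) k) N →
            f (Tkn (n ∸ 1) k) N ≡ 2 ^ (n ∸ 1) * ((n ∸ 1) C k)
lemma19 n k _ 2≤k _ = optimal-value-of-pointwise-minimum (Tkn (n ∸ 1) k) ((n ∸ 1) C k)
  (cost-Tkn-false (n ∸ 1) k) (C≤cost-Tkn (n ∸ 1) k (<⇒≤ 2≤k))
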